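{- Let $p$ be a prime and $n\ge1$. For an integer $1\le i\le n$ the following are equivalent: (a) $i'p^{j_n(i')}\ge ip^{j_n(i)}$ for every integer $1\le i'\le i$; (b) $i=\lceil n/p^k\rceil$ for some integer $k\ge0$.
   Context: For $1\le i\le n$, $j_n(i)=\lceil\log_p(n/i)\rceil$, i.e. the least integer $j\ge0$ with $ip^j\ge n$. -}

module Defs where

open import Data.Nat using (ℕ; _+_; _*_; _∸_; _^_; _≤_; _<_; _≥_; NonZero)
open import Data.Nat.DivMod using (_/_)
open import Data.Product using (_×_)

-- IsJ p n i j : j is the least natural number with i * p ^ j ≥ n,
-- i.e. j = j_n(i) = ⌈log_p (n / i)⌉ (the paper's definition).
IsJ : ℕ → ℕ → ℕ → ℕ → Set
IsJ p n i j = (i * p ^ j ≥ n) × (∀ j′ → j′ < j → i * p ^ j′ < n)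

⌈_/_⌉ : ℕ → (d : ℕ) → .{{NonZero d}} → ℕ
⌈ n / d ⌉ = (n + d ∸ 1) / d

module Submission where

-- Write C k = ⌈ n / p ^ k ⌉ and j(x) = j_n(x), the least j with x * p ^ j ≥ n.
-- Two elementary facts drive the proof.
--   * Galois connection of ceiling division: C k ≤ x  iff  n ≤ x * p ^ k.
--     Hence C is antitone in k, and j(x) ≤ k as soon as n ≤ x * p ^ k.
--   * A fixed point property: if i = C k then also i = C (j(i)); indeed
--     j(i) ≤ k gives C k ≤ C (j(i)) ≤ i.
-- (b) ⇒ (a): let i = C k, j = j(i), i′ ≤ i and j′ = j(i′). Then j ≤ j′, and
--   n ≤ i′ * p ^ j′ = (i′ * p ^ (j′ ∸ j)) * p ^ j, so the Galois connection
--   gives i = C j ≤ i′ * p ^ (j′ ∸ j); multiply by p ^ j.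
-- (a) ⇒ (b): let j = j(i) and c = C j ≤ i. Then j(c) ≤ j, and (a) applied to
--   i′ = c yields i * p ^ j ≤ c * p ^ j(c) ≤ c * p ^ j, so i ≤ c, i.e. i = C j.

open import Defs
open import Data.Nat using (ℕ; _*_; _^_; _≤_; _<_; _≥_; NonZero)
open import Data.Nat.Properties using (m^n≢0)
open import Data.Nat.Primality using (Prime; prime⇒nonZero)
open import Data.Product using (_×_; ∃-syntax)
open import Function.Bundles using (_⇔_)
open import Relation.Binary.PropositionalEquality using (_≡_)

open import Data.Nat using (zero; suc; _+_; _∸_; z≤n; s≤s; _≤?_; nonTrivial⇒n>1; >-nonZero; >-nonZero⁻¹)
open import Data.Nat.Properties
open import Data.Nat.DivMod using (_/_; _%_; m≡m%n+[m/n]*n; m%n<n; m<n*o⇒m/o<n)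
open import Data.Nat.Primality using (prime⇒nonTrivial)
open import Data.Product using (_,_; proj₁)
open import Relation.Nullary using (¬_; yes; no)
open import Relation.Unary using (Pred; Decidable)
open import Relation.Binary.PropositionalEquality using (refl; sym; cong; subst; module ≡-Reasoning)
open import Function.Bundles using (mk⇔)

n≤⌈n/d⌉*d : ∀ n d .{{_ : NonZero d}} → n ≤ ⌈ n / d ⌉ * d
n≤⌈n/d⌉*d n d = +-cancelʳ-≤ d n (q * d) n+d≤q*d+d
  where
  open ≤-Reasoning
  m = n + d ∸ 1
  q = m / d
  1+m≡n+d : suc m ≡ n + d
  1+m≡n+d = m+[n∸m]≡n (≤-trans (>-nonZero⁻¹ d) (m≤n+m d n))
  n+d≤q*d+d : n + d ≤ q * d + d
  n+d≤q*d+d = begin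
    n + d              ≡⟨ sym 1+m≡n+d ⟩
    suc m              ≡⟨ cong suc (m≡m%n+[m/n]*n m d) ⟩
    suc (m % d) + q * d ≤⟨ +-monoˡ-≤ (q * d) (m%n<n m d) ⟩
    d + q * d          ≡⟨ +-comm d (q * d) ⟩
    q * d + d          ∎

⌈n/d⌉-least : ∀ n d x .{{_ : NonZero d}} → n ≤ x * d → ⌈ n / d ⌉ ≤ x
⌈n/d⌉-least n d x n≤x*d = ≤-pred (m<n*o⇒m/o<n n+d∸1<[1+x]*d)
  where
  open ≤-Reasoning
  n+d∸1<[1+x]*d : n + d ∸ 1 < suc x * d
  n+d∸1<[1+x]*d = begin-strict
    n + d ∸ 1 <⟨ ∸-monoʳ-< (s≤s z≤n) (≤-trans (>-nonZero⁻¹ d) (m≤n+m d n)) ⟩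
    n + d ∸ 0 ≤⟨ +-monoˡ-≤ d n≤x*d ⟩
    x * d + d ≡⟨ +-comm (x * d) d ⟩
    suc x * d ∎

-- A decidable, upward closed predicate on ℕ that holds somewhere holds at a
-- least point: scanning down from the witness b, the first failure of P
-- bounds everything below it.
least-witness : ∀ {ℓ} (P : Pred ℕ ℓ) → Decidable P → (∀ {k l} → k ≤ l → P k → P l) →
                ∀ b → P b → ∃[ m ] (P m × (∀ k → k < m → ¬ P k))
least-witness P P? up zero    P0   = zero , P0 , λ _ ()
least-witness P P? up (suc b) P1+b with P? b
... | yes Pb = least-witness P P? up b Pb
... | no ¬Pb = suc b , P1+b , λ k k<1+b Pk → ¬Pb (up (≤-pred k<1+b) Pk)

n<p^n : ∀ p → 1 < p → ∀ n → n < p ^ n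
n<p^n p p>1 zero    = s≤s z≤n
n<p^n p p>1 (suc n) = begin-strict
  suc n     ≤⟨ n<p^n p p>1 n ⟩
  p ^ n     <⟨ m<m*n (p ^ n) p p>1 ⟩
  p ^ n * p ≡⟨ *-comm (p ^ n) p ⟩
  p * p ^ n ∎
  where
  open ≤-Reasoning
  instance _ = >-nonZero (≤-trans (s≤s z≤n) (n<p^n p p>1 n))

module Ceilings (p : ℕ) .{{_ : NonZero p}} (n : ℕ) where

  C : ℕ → ℕ
  C k = ⌈_/_⌉ n (p ^ k) {{m^n≢0 p k}}

  C-covers : ∀ k → n ≤ C k * p ^ k
  C-covers k = n≤⌈n/d⌉*d n (p ^ k) {{m^n≢0 p k}}

  C-least : ∀ k x → n ≤ x * p ^ k → C k ≤ x
  C-least k x = ⌈n/d⌉-least n (p ^ k) x {{m^n≢0 p k}}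

  C-antitone : ∀ k l → k ≤ l → C l ≤ C k
  C-antitone k l k≤l =
    C-least l (C k) (≤-trans (C-covers k) (*-monoʳ-≤ (C k) (^-monoʳ-≤ p k≤l)))

  C-positive : 1 ≤ n → ∀ k → 1 ≤ C k
  C-positive n≥1 k = n≢0⇒n>0 λ Ck≡0 →
    <⇒≱ n≥1 (subst (λ c → n ≤ c * p ^ k) Ck≡0 (C-covers k))

  isJ-least : ∀ x {j k} → IsJ p n x j → n ≤ x * p ^ k → j ≤ k
  isJ-least x {k = k} (_ , below) n≤x*p^k = ≮⇒≥ λ k<j → <⇒≱ (below k k<j) n≤x*p^k

  -- For p ≥ 2 and x ≥ 1, j(x) exists: x * p ^ n ≥ n bounds the search.
  isJ-exists : 1 < p → ∀ x → 1 ≤ x → ∃[ j ] IsJ p n x j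
  isJ-exists p>1 x x≥1 with least-witness Reaches reaches? upward n n≤x*p^n
    where
    Reaches : Pred ℕ _
    Reaches k = n ≤ x * p ^ k
    reaches? : Decidable Reaches
    reaches? k = n ≤? x * p ^ k
    upward : ∀ {k l} → k ≤ l → Reaches k → Reaches l
    upward k≤l r = ≤-trans r (*-monoʳ-≤ x (^-monoʳ-≤ p k≤l))
    n≤x*p^n : Reaches n
    n≤x*p^n = ≤-trans (<⇒≤ (n<p^n p p>1 n))
                (subst (_≤ x * p ^ n) (*-identityˡ (p ^ n)) (*-monoˡ-≤ (p ^ n) x≥1))
  ... | j , reaches , smaller = j , reaches , λ k k<j → ≰⇒> (smaller k k<j)

  C-at-isJ : ∀ {i} k {j} → i ≡ C k → IsJ p n i j → i ≡ C j
  C-at-isJ k {j} refl Jij = ≤-antisym (C-antitone j k j≤k) (C-least j (C k) (proj₁ Jij))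
    where
    j≤k : j ≤ k
    j≤k = isJ-least (C k) Jij (C-covers k)

  PrefixMinimum : ℕ → Set
  PrefixMinimum i = ∀ i′ j′ j → 1 ≤ i′ → i′ ≤ i → IsJ p n i′ j′ → IsJ p n i j →
                    i′ * p ^ j′ ≥ i * p ^ j

  ceiling⇒prefixMinimum : ∀ {i} k → i ≡ C k → PrefixMinimum i
  ceiling⇒prefixMinimum {i} k i≡Ck i′ j′ j _ i′≤i Ji′j′ Jij = begin
    i * p ^ j                ≤⟨ *-monoˡ-≤ (p ^ j) i≤i′*p^t ⟩
    i′ * p ^ t * p ^ j       ≡⟨ regroup ⟩
    i′ * p ^ j′              ∎
    where
    open ≤-Reasoning
    j≤j′ : j ≤ j′
    j≤j′ = isJ-least i Jij (≤-trans (proj₁ Ji′j′) (*-monoˡ-≤ (p ^ j′) i′≤i))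
    t = j′ ∸ j
    regroup : i′ * p ^ t * p ^ j ≡ i′ * p ^ j′
    regroup = ≡.begin
      i′ * p ^ t * p ^ j   ≡.≡⟨ *-assoc i′ (p ^ t) (p ^ j) ⟩
      i′ * (p ^ t * p ^ j) ≡.≡⟨ cong (i′ *_) (sym (^-distribˡ-+-* p t j)) ⟩
      i′ * p ^ (t + j)     ≡.≡⟨ cong (λ e → i′ * p ^ e) (m∸n+n≡m j≤j′) ⟩
      i′ * p ^ j′          ≡.∎
      where module ≡ = ≡-Reasoning
    i≤i′*p^t : i ≤ i′ * p ^ t
    i≤i′*p^t = subst (_≤ i′ * p ^ t) (sym (C-at-isJ k i≡Ck Jij))
                 (C-least j (i′ * p ^ t) (subst (n ≤_) (sym regroup) (proj₁ Ji′j′)))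

  prefixMinimum⇒ceiling : 1 < p → 1 ≤ n → ∀ {i} → 1 ≤ i → PrefixMinimum i → ∃[ k ] i ≡ C k
  prefixMinimum⇒ceiling p>1 n≥1 {i} i≥1 minimal with isJ-exists p>1 i i≥1
  ... | j , Jij with isJ-exists p>1 (C j) (C-positive n≥1 j)
  ... | j′ , Jcj′ = j , ≤-antisym i≤c c≤i
    where
    c≤i : C j ≤ i
    c≤i = C-least j i (proj₁ Jij)
    j′≤j : j′ ≤ j
    j′≤j = isJ-least (C j) Jcj′ (C-covers j)
    i≤c : i ≤ C j
    i≤c = *-cancelʳ-≤ i (C j) (p ^ j) {{m^n≢0 p j}}
            (≤-trans (minimal (C j) j′ j (C-positive n≥1 j) c≤i Jcj′ Jij)
                     (*-monoʳ-≤ (C j) (^-monoʳ-≤ p j′≤j)))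

lemma4p1 : (p n : ℕ) → (pp : Prime p) → 1 ≤ n → (i : ℕ) → 1 ≤ i → i ≤ n →
    ((∀ i′ j′ j → 1 ≤ i′ → i′ ≤ i → IsJ p n i′ j′ → IsJ p n i j → i′ * p ^ j′ ≥ i * p ^ j)
      ⇔ (∃[ k ] i ≡ ⌈_/_⌉ n (p ^ k) {{m^n≢0 p k {{prime⇒nonZero pp}}}}))
lemma4p1 p n pp n≥1 i i≥1 _ =
  mk⇔ (prefixMinimum⇒ceiling p>1 n≥1 i≥1) (λ (k , i≡Ck) → ceiling⇒prefixMinimum k i≡Ck)
  where
  open Ceilings p {{prime⇒nonZero pp}} n
  p>1 : 1 < p
  p>1 = nonTrivial⇒n>1 p {{prime⇒nonTrivial pp}}
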